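{- Let $S_0=\begin{pmatrix}0&1\\1&0\end{pmatrix}$, $M_1=\begin{pmatrix}1_2&0\\S_0&1_2\end{pmatrix}$ and $K=\begin{pmatrix}0&-1_2\\1_2&S_0\end{pmatrix}$. Then each of $\{1_4,M_1\}$ and $\{1_4,K\}$ is a complete set of representatives of the double coset space $\Gamma_0(3)\backslash Sp(2,\mathbb Z)/\Gamma_{\mathrm{diag}}$.
   Context: $\Gamma_0(3)=\{\begin{pmatrix}A&B\\C&D\end{pmatrix}\in Sp(2,\mathbb Z):C\equiv0\bmod3\}$. $\Gamma_{\mathrm{diag}}$ is the image of $SL_2(\mathbb Z)\times SL_2(\mathbb Z)$ in $Sp(2,\mathbb Z)$ under $\iota\big(\begin{pmatrix}a_1&b_1\\c_1&d_1\end{pmatrix},\begin{pmatrix}a_2&b_2\\c_2&d_2\end{pmatrix}\big)=\begin{pmatrix}a_1&0&b_1&0\\0&a_2&0&b_2\\c_1&0&d_1&0\\0&c_2&0&d_2\end{pmatrix}$. -}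

module Defs where

open import Data.Integer using (ℤ; +_; -_; _+_; _*_; _-_)
open import Data.Integer.Divisibility using (_∣_)
open import Data.Fin using (Fin; zero; suc)
open import Data.Vec using (Vec; []; _∷_; lookup)
open import Data.Product using (Σ; _×_; _,_; ∃)
open import Data.Sum using (_⊎_)
open import Relation.Binary.PropositionalEquality using (_≡_)
open import Relation.Nullary using (¬_)

Mat : Set
Mat = Fin 4 → Fin 4 → ℤ

Mat2 : Set
Mat2 = Fin 2 → Fin 2 → ℤ

fromRows : Vec (Vec ℤ 4) 4 → Mat
fromRows v i j = lookup (lookup v i) j

_≈_ : Mat → Mat → Set
A ≈ B = ∀ i j → A i j ≡ B i j
infix 4 _≈_

f0 f1 f2 f3 : Fin 4
f0 = zero
f1 = suc zero
f2 = suc (suc zero)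
f3 = suc (suc (suc zero))

_·_ : Mat → Mat → Mat
(A · B) i j = A i f0 * B f0 j + A i f1 * B f1 j + A i f2 * B f2 j + A i f3 * B f3 j
infixl 7 _·_

transpose : Mat → Mat
transpose A i j = A j i

1₄ : Mat
1₄ = fromRows ((+ 1 ∷ + 0 ∷ + 0 ∷ + 0 ∷ []) ∷
               (+ 0 ∷ + 1 ∷ + 0 ∷ + 0 ∷ []) ∷
               (+ 0 ∷ + 0 ∷ + 1 ∷ + 0 ∷ []) ∷
               (+ 0 ∷ + 0 ∷ + 0 ∷ + 1 ∷ []) ∷ [])

J : Mat
J = fromRows ((+ 0 ∷ + 0 ∷ + 1 ∷ + 0 ∷ []) ∷
              (+ 0 ∷ + 0 ∷ + 0 ∷ + 1 ∷ []) ∷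
              (- + 1 ∷ + 0 ∷ + 0 ∷ + 0 ∷ []) ∷
              (+ 0 ∷ - + 1 ∷ + 0 ∷ + 0 ∷ []) ∷ [])

IsSp : Mat → Set
IsSp M = transpose M · J · M ≈ J

-- Γ₀(3): symplectic with lower-left 2×2 block C ≡ 0 mod 3
IsΓ₀3 : Mat → Set
IsΓ₀3 M = IsSp M × (∀ (i j : Fin 2) → (+ 3) ∣ M (suc (suc i)) (j Data.Fin.↑ˡ 2))

IsSL2 : Mat2 → Set
IsSL2 g = g zero zero * g (suc zero) (suc zero) - g zero (suc zero) * g (suc zero) zero ≡ + 1

ι : Mat2 → Mat2 → Mat
ι g h = fromRows ((a₁ ∷ + 0 ∷ b₁ ∷ + 0 ∷ []) ∷
                  (+ 0 ∷ a₂ ∷ + 0 ∷ b₂ ∷ []) ∷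
                  (c₁ ∷ + 0 ∷ d₁ ∷ + 0 ∷ []) ∷
                  (+ 0 ∷ c₂ ∷ + 0 ∷ d₂ ∷ []) ∷ [])
  where
  a₁ = g zero zero
  b₁ = g zero (suc zero)
  c₁ = g (suc zero) zero
  d₁ = g (suc zero) (suc zero)
  a₂ = h zero zero
  b₂ = h zero (suc zero)
  c₂ = h (suc zero) zero
  d₂ = h (suc zero) (suc zero)

IsΓdiag : Mat → Set
IsΓdiag M = Σ Mat2 λ g → Σ Mat2 λ h → IsSL2 g × IsSL2 h × (M ≈ ι g h)

InDoubleCoset : Mat → Mat → Set
InDoubleCoset R N = Σ Mat λ γ → Σ Mat λ δ → IsΓ₀3 γ × IsΓdiag δ × (N ≈ γ · R · δ)

CompleteReps₂ : Mat → Mat → Set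
CompleteReps₂ R₁ R₂ =
  IsSp R₁ × IsSp R₂ ×
  (∀ (N : Mat) → IsSp N → InDoubleCoset R₁ N ⊎ InDoubleCoset R₂ N) ×
  ¬ InDoubleCoset R₁ R₂

M₁ : Mat
M₁ = fromRows ((+ 1 ∷ + 0 ∷ + 0 ∷ + 0 ∷ []) ∷
               (+ 0 ∷ + 1 ∷ + 0 ∷ + 0 ∷ []) ∷
               (+ 0 ∷ + 1 ∷ + 1 ∷ + 0 ∷ []) ∷
               (+ 1 ∷ + 0 ∷ + 0 ∷ + 1 ∷ []) ∷ [])

K : Mat
K = fromRows ((+ 0 ∷ + 0 ∷ - + 1 ∷ + 0 ∷ []) ∷
              (+ 0 ∷ + 0 ∷ + 0 ∷ - + 1 ∷ []) ∷
              (+ 1 ∷ + 0 ∷ + 0 ∷ + 1 ∷ []) ∷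
              (+ 0 ∷ + 1 ∷ + 1 ∷ + 0 ∷ []) ∷ [])

{-# OPTIONS --safe #-}
module Submission where

-- The double coset of N ∈ Sp(2,ℤ) only depends on the bottom rows N₂, N₃ of N
-- modulo 3: if they are orthogonal modulo 3, for ω(x, y) = x J yᵀ, to the bottom
-- rows of Q = R·ι(g,h), then N Q⁻¹ ∈ Γ₀(3) and so N ∈ Γ₀(3) R Γ_diag. The rows
-- N₂, N₃ are ω-isotropic, because the left inverse J Nᵀ Jᵀ of N is also a right
-- inverse: det N = -pf(Nᵀ J N) = 1. A finite search over residues shows that every
-- isotropic pair of rows is ω-orthogonal modulo 3 to the bottom rows of one of
-- finitely many explicit Q with R = 1₄, or else to those of such Q with R = M₁ and
-- to those of such Q with R = K. Conversely, for γ ∈ Γ₀(3) the minor in rows 2, 3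
-- and columns 0, 2 of γ·ι(g,h) is that of γ times det g, hence divisible by 3,
-- while it is -1 for M₁ and 1 for K.

open import Defs
open import Data.Product using (_×_; _,_; proj₁; proj₂)
open import Data.Sum using (_⊎_; inj₁; inj₂)
import Data.Nat as ℕ
import Data.Nat.Divisibility as ℕ
open import Data.Integer as ℤ using (ℤ; +_; -_; _+_; _*_; _-_)
open import Data.Integer.Properties using (neg-injective; *-identityʳ; *-zeroʳ; +-inverseʳ)
open import Data.Integer.DivMod using (_%ℕ_; _/ℕ_; a≡a%ℕn+[a/ℕn]*n; n%ℕd<d)
import Data.Integer.Divisibility as Unsigned
open import Data.Integer.Divisibility.Signed
  using (_∣_; divides; ∣ᵤ⇒∣; ∣⇒∣ᵤ; ∣m∣n⇒∣m+n; ∣m∣n⇒∣m-n; ∣m⇒∣m*n; ∣n⇒∣m*n; ∣m⇒∣-m)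
open import Data.Integer.Tactic.RingSolver using (solve-∀)
open import Data.Fin using (Fin; zero; suc; _↑ˡ_)
open import Data.Fin.Properties using (all?)
open import Data.Vec using (Vec; []; _∷_; lookup; tabulate)
open import Data.Vec.Properties using (lookup∘tabulate)
open import Data.List as List using (List; []; _∷_; cartesianProduct; cartesianProductWith)
open import Data.List.Membership.Propositional using (_∈_)
open import Data.List.Membership.Propositional.Properties using (∈-cartesianProductWith⁺)
open import Data.List.Relation.Unary.All as All using (All; lookupAny)
open import Data.List.Relation.Unary.Any as Any using (Any; here; there; any?)
open import Data.List.Relation.Unary.Any.Properties using (map⁻)
open import Function using (_∘_)
open import Relation.Binary using (Setoid; IsEquivalence; Decidable)
open import Relation.Binary.PropositionalEquality using (_≡_; refl; sym; trans; cong; cong₂; subst)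
import Relation.Binary.Reasoning.Setoid as SetoidReasoning
open import Relation.Nullary using (Dec; ¬_)
open import Relation.Nullary.Decidable using (_×-dec_; _⊎-dec_; _→-dec_; map′; from-yes; from-no)

≈-isEquivalence : IsEquivalence _≈_
≈-isEquivalence = record
  { refl  = λ i j → refl
  ; sym   = λ p i j → sym (p i j)
  ; trans = λ p q i j → trans (p i j) (q i j)
  }

≈-setoid : Setoid _ _
≈-setoid = record { isEquivalence = ≈-isEquivalence }

open IsEquivalence ≈-isEquivalence using () renaming (refl to ≈-refl; sym to ≈-sym; trans to ≈-trans)

infix 4 _≈?_
_≈?_ : Decidable _≈_
A ≈? B = all? λ i → all? λ j → A i j ℤ.≟ B i j

·-cong-entry : ∀ {A A′ B B′ i j} → (∀ k → A i k ≡ A′ i k) → (∀ k → B k j ≡ B′ k j) →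
               (A · B) i j ≡ (A′ · B′) i j
·-cong-entry p q =
  cong₂ _+_ (cong₂ _+_ (cong₂ _+_ (cong₂ _*_ (p f0) (q f0)) (cong₂ _*_ (p f1) (q f1)))
                       (cong₂ _*_ (p f2) (q f2)))
            (cong₂ _*_ (p f3) (q f3))

·-cong : ∀ {A A′ B B′} → A ≈ A′ → B ≈ B′ → A · B ≈ A′ · B′
·-cong {A} {A′} {B} {B′} p q i j = ·-cong-entry {A} {A′} {B} {B′} (p i) (λ k → q k j)

·-congˡ : ∀ {A A′} B → A ≈ A′ → A · B ≈ A′ · B
·-congˡ {A} {A′} B p = ·-cong {A} {A′} {B} {B} p ≈-refl

·-congʳ : ∀ A {B B′} → B ≈ B′ → A · B ≈ A · B′
·-congʳ A {B} {B′} q = ·-cong {A} {A} {B} {B′} ≈-refl q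

·-assoc : ∀ A B C → (A · B) · C ≈ A · (B · C)
·-assoc A B C i j =
  polynomial (A i f0) (A i f1) (A i f2) (A i f3)
             (B f0 f0) (B f0 f1) (B f0 f2) (B f0 f3) (B f1 f0) (B f1 f1) (B f1 f2) (B f1 f3)
             (B f2 f0) (B f2 f1) (B f2 f2) (B f2 f3) (B f3 f0) (B f3 f1) (B f3 f2) (B f3 f3)
             (C f0 j) (C f1 j) (C f2 j) (C f3 j)
  where
  polynomial : ∀ a₀ a₁ a₂ a₃ b₀₀ b₀₁ b₀₂ b₀₃ b₁₀ b₁₁ b₁₂ b₁₃ b₂₀ b₂₁ b₂₂ b₂₃ b₃₀ b₃₁ b₃₂ b₃₃ c₀ c₁ c₂ c₃ →
    (a₀ * b₀₀ + a₁ * b₁₀ + a₂ * b₂₀ + a₃ * b₃₀) * c₀ + (a₀ * b₀₁ + a₁ * b₁₁ + a₂ * b₂₁ + a₃ * b₃₁) * c₁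
      + (a₀ * b₀₂ + a₁ * b₁₂ + a₂ * b₂₂ + a₃ * b₃₂) * c₂ + (a₀ * b₀₃ + a₁ * b₁₃ + a₂ * b₂₃ + a₃ * b₃₃) * c₃
    ≡ a₀ * (b₀₀ * c₀ + b₀₁ * c₁ + b₀₂ * c₂ + b₀₃ * c₃) + a₁ * (b₁₀ * c₀ + b₁₁ * c₁ + b₁₂ * c₂ + b₁₃ * c₃)
      + a₂ * (b₂₀ * c₀ + b₂₁ * c₁ + b₂₂ * c₂ + b₂₃ * c₃) + a₃ * (b₃₀ * c₀ + b₃₁ * c₁ + b₃₂ * c₂ + b₃₃ * c₃)
  polynomial = solve-∀

·-identityʳ : ∀ A → A · 1₄ ≈ A
·-identityʳ A i zero = polynomial (A i f0) (A i f1) (A i f2) (A i f3)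
  where polynomial : ∀ a₀ a₁ a₂ a₃ → a₀ * + 1 + a₁ * + 0 + a₂ * + 0 + a₃ * + 0 ≡ a₀
        polynomial = solve-∀
·-identityʳ A i (suc zero) = polynomial (A i f0) (A i f1) (A i f2) (A i f3)
  where polynomial : ∀ a₀ a₁ a₂ a₃ → a₀ * + 0 + a₁ * + 1 + a₂ * + 0 + a₃ * + 0 ≡ a₁
        polynomial = solve-∀
·-identityʳ A i (suc (suc zero)) = polynomial (A i f0) (A i f1) (A i f2) (A i f3)
  where polynomial : ∀ a₀ a₁ a₂ a₃ → a₀ * + 0 + a₁ * + 0 + a₂ * + 1 + a₃ * + 0 ≡ a₂
        polynomial = solve-∀
·-identityʳ A i (suc (suc (suc zero))) = polynomial (A i f0) (A i f1) (A i f2) (A i f3)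
  where polynomial : ∀ a₀ a₁ a₂ a₃ → a₀ * + 0 + a₁ * + 0 + a₂ * + 0 + a₃ * + 1 ≡ a₃
        polynomial = solve-∀

transpose-· : ∀ A B → transpose (A · B) ≈ transpose B · transpose A
transpose-· A B i j = polynomial (A j f0) (A j f1) (A j f2) (A j f3) (B f0 i) (B f1 i) (B f2 i) (B f3 i)
  where
  polynomial : ∀ a₀ a₁ a₂ a₃ b₀ b₁ b₂ b₃ →
               a₀ * b₀ + a₁ * b₁ + a₂ * b₂ + a₃ * b₃ ≡ b₀ * a₀ + b₁ * a₁ + b₂ * a₂ + b₃ * a₃
  polynomial = solve-∀

transpose-cong : ∀ {A B} → A ≈ B → transpose A ≈ transpose B
transpose-cong p i j = p j i

-- Symplectic matrices

IsSp-· : ∀ {A B} → IsSp A → IsSp B → IsSp (A · B)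
IsSp-· {A} {B} spA spB = begin
  transpose (A · B) · J · (A · B)          ≈⟨ ·-congˡ (A · B) (·-congˡ J (transpose-· A B)) ⟩
  transpose B · transpose A · J · (A · B)  ≈⟨ ·-assoc (transpose B · transpose A · J) A B ⟨
  transpose B · transpose A · J · A · B
    ≈⟨ ·-congˡ B (≈-trans (·-congˡ A (·-assoc (transpose B) (transpose A) J))
                          (·-assoc (transpose B) (transpose A · J) A)) ⟩
  transpose B · (transpose A · J · A) · B  ≈⟨ ·-congˡ B (·-congʳ (transpose B) spA) ⟩
  transpose B · J · B                      ≈⟨ spB ⟩
  J                                        ∎
  where open SetoidReasoning ≈-setoid

IsSp-J : IsSp J
IsSp-J = from-yes (transpose J · J · J ≈? J)

IsSp-Jᵀ : IsSp (transpose J)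
IsSp-Jᵀ = from-yes (J · J · transpose J ≈? J)

spInverse : Mat → Mat
spInverse Q = J · transpose Q · transpose J

spInverse-inverseˡ : ∀ {Q} → IsSp Q → spInverse Q · Q ≈ 1₄
spInverse-inverseˡ {Q} sp = begin
  J · transpose Q · transpose J · Q        ≈⟨ ·-assoc (J · transpose Q) (transpose J) Q ⟩
  J · transpose Q · (transpose J · Q)      ≈⟨ ·-assoc J (transpose Q) (transpose J · Q) ⟩
  J · (transpose Q · (transpose J · Q))
    ≈⟨ ·-congʳ J (≈-trans (transpose-· (transpose Q · J) Q)
                          (·-congʳ (transpose Q) (transpose-· (transpose Q) J))) ⟨
  J · transpose (transpose Q · J · Q)      ≈⟨ ·-congʳ J (transpose-cong sp) ⟩
  J · transpose J                          ≈⟨ from-yes (J · transpose J ≈? 1₄) ⟩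
  1₄                                       ∎
  where open SetoidReasoning ≈-setoid

IsSp-spInverse : ∀ {Q} → IsSp (transpose Q) → IsSp (spInverse Q)
IsSp-spInverse {Q} spQᵀ =
  IsSp-· {J · transpose Q} {transpose J} (IsSp-· {J} {transpose Q} IsSp-J spQᵀ) IsSp-Jᵀ

ω : (Fin 4 → ℤ) → (Fin 4 → ℤ) → ℤ
ω x y = x f0 * y f2 + x f1 * y f3 - x f2 * y f0 - x f3 * y f1

ω-antisym : ∀ x y → ω x y ≡ - ω y x
ω-antisym x y = polynomial (x f0) (x f1) (x f2) (x f3) (y f0) (y f1) (y f2) (y f3)
  where
  polynomial : ∀ x₀ x₁ x₂ x₃ y₀ y₁ y₂ y₃ →
               x₀ * y₂ + x₁ * y₃ - x₂ * y₀ - x₃ * y₁ ≡ - (y₀ * x₂ + y₁ * x₃ - y₂ * x₀ - y₃ * x₁)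
  polynomial = solve-∀

ω-entry : ∀ A B i j → (A · J · transpose B) i j ≡ ω (A i) (B j)
ω-entry A B i j = polynomial (A i f0) (A i f1) (A i f2) (A i f3) (B j f0) (B j f1) (B j f2) (B j f3)
  where
  polynomial : ∀ a₀ a₁ a₂ a₃ b₀ b₁ b₂ b₃ →
    (a₀ * + 0 + a₁ * + 0 + a₂ * - + 1 + a₃ * + 0) * b₀ + (a₀ * + 0 + a₁ * + 0 + a₂ * + 0 + a₃ * - + 1) * b₁
      + (a₀ * + 1 + a₁ * + 0 + a₂ * + 0 + a₃ * + 0) * b₂ + (a₀ * + 0 + a₁ * + 1 + a₂ * + 0 + a₃ * + 0) * b₃
    ≡ a₀ * b₂ + a₁ * b₃ - a₂ * b₀ - a₃ * b₁
  polynomial = solve-∀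

bottom : Mat → Fin 2 → Fin 4 → ℤ
bottom A i = A (suc (suc i))

·Jᵀ-leftColumns : ∀ X r (j : Fin 2) → (X · transpose J) r (j ↑ˡ 2) ≡ X r (suc (suc j))
·Jᵀ-leftColumns X r zero = polynomial (X r f0) (X r f1) (X r f2) (X r f3)
  where polynomial : ∀ x₀ x₁ x₂ x₃ → x₀ * + 0 + x₁ * + 0 + x₂ * + 1 + x₃ * + 0 ≡ x₂
        polynomial = solve-∀
·Jᵀ-leftColumns X r (suc zero) = polynomial (X r f0) (X r f1) (X r f2) (X r f3)
  where polynomial : ∀ x₀ x₁ x₂ x₃ → x₀ * + 0 + x₁ * + 0 + x₂ * + 0 + x₃ * + 1 ≡ x₃
        polynomial = solve-∀

spInverse-lowerLeft : ∀ N Q (i j : Fin 2) →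
                      (N · spInverse Q) (suc (suc i)) (j ↑ˡ 2) ≡ ω (bottom N i) (bottom Q j)
spInverse-lowerLeft N Q i j = begin
  (N · spInverse Q) r (j ↑ˡ 2)                    ≡⟨ reassociate r (j ↑ˡ 2) ⟩
  (N · J · transpose Q · transpose J) r (j ↑ˡ 2)  ≡⟨ ·Jᵀ-leftColumns (N · J · transpose Q) r j ⟩
  (N · J · transpose Q) r (suc (suc j))           ≡⟨ ω-entry N Q r (suc (suc j)) ⟩
  ω (N r) (Q (suc (suc j)))                       ∎
  where
  open Relation.Binary.PropositionalEquality.≡-Reasoning
  r : Fin 4
  r = suc (suc i)
  reassociate : N · spInverse Q ≈ N · J · transpose Q · transpose J
  reassociate = ≈-sym (≈-trans (·-congˡ (transpose J) (·-assoc N J (transpose Q)))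
                               (·-assoc N (J · transpose Q) (transpose J)))

det₃ : (a b c d e f g h i : ℤ) → ℤ
det₃ a b c d e f g h i = a * (e * i - f * h) - b * (d * i - f * g) + c * (d * h - e * g)

cofactor₀ : Mat → Fin 4 → ℤ
cofactor₀ A zero =
  det₃ (A f1 f1) (A f1 f2) (A f1 f3) (A f2 f1) (A f2 f2) (A f2 f3) (A f3 f1) (A f3 f2) (A f3 f3)
cofactor₀ A (suc zero) =
  - det₃ (A f1 f0) (A f1 f2) (A f1 f3) (A f2 f0) (A f2 f2) (A f2 f3) (A f3 f0) (A f3 f2) (A f3 f3)
cofactor₀ A (suc (suc zero)) =
  det₃ (A f1 f0) (A f1 f1) (A f1 f3) (A f2 f0) (A f2 f1) (A f2 f3) (A f3 f0) (A f3 f1) (A f3 f3)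
cofactor₀ A (suc (suc (suc zero))) =
  - det₃ (A f1 f0) (A f1 f1) (A f1 f2) (A f2 f0) (A f2 f1) (A f2 f2) (A f3 f0) (A f3 f1) (A f3 f2)

det : Mat → ℤ
det A = A f0 f0 * cofactor₀ A f0 + A f0 f1 * cofactor₀ A f1 + A f0 f2 * cofactor₀ A f2 + A f0 f3 * cofactor₀ A f3

-- Every column of cofactors₀ A is the first column of the adjugate of A.
cofactors₀ : Mat → Mat
cofactors₀ A i _ = cofactor₀ A i

-- Expansion along row 0 for k = 0, and expansion by alien cofactors otherwise.
·-cofactors₀ : ∀ A k → (A · cofactors₀ A) k f0 ≡ det A * 1₄ k f0
·-cofactors₀ A zero = sym (*-identityʳ (det A))
·-cofactors₀ A (suc zero) =
  trans (polynomial (A f1 f0) (A f1 f1) (A f1 f2) (A f1 f3) (A f2 f0) (A f2 f1) (A f2 f2) (A f2 f3)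
                    (A f3 f0) (A f3 f1) (A f3 f2) (A f3 f3))
        (sym (*-zeroʳ (det A)))
  where
  polynomial : ∀ x₁₀ x₁₁ x₁₂ x₁₃ x₂₀ x₂₁ x₂₂ x₂₃ x₃₀ x₃₁ x₃₂ x₃₃ →
    x₁₀ * (x₁₁ * (x₂₂ * x₃₃ - x₂₃ * x₃₂) - x₁₂ * (x₂₁ * x₃₃ - x₂₃ * x₃₁) + x₁₃ * (x₂₁ * x₃₂ - x₂₂ * x₃₁))
      + x₁₁ * - (x₁₀ * (x₂₂ * x₃₃ - x₂₃ * x₃₂) - x₁₂ * (x₂₀ * x₃₃ - x₂₃ * x₃₀) + x₁₃ * (x₂₀ * x₃₂ - x₂₂ * x₃₀))
      + x₁₂ * (x₁₀ * (x₂₁ * x₃₃ - x₂₃ * x₃₁) - x₁₁ * (x₂₀ * x₃₃ - x₂₃ * x₃₀) + x₁₃ * (x₂₀ * x₃₁ - x₂₁ * x₃₀))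
      + x₁₃ * - (x₁₀ * (x₂₁ * x₃₂ - x₂₂ * x₃₁) - x₁₁ * (x₂₀ * x₃₂ - x₂₂ * x₃₀) + x₁₂ * (x₂₀ * x₃₁ - x₂₁ * x₃₀))
    ≡ + 0
  polynomial = solve-∀
·-cofactors₀ A (suc (suc zero)) =
  trans (polynomial (A f1 f0) (A f1 f1) (A f1 f2) (A f1 f3) (A f2 f0) (A f2 f1) (A f2 f2) (A f2 f3)
                    (A f3 f0) (A f3 f1) (A f3 f2) (A f3 f3))
        (sym (*-zeroʳ (det A)))
  where
  polynomial : ∀ x₁₀ x₁₁ x₁₂ x₁₃ x₂₀ x₂₁ x₂₂ x₂₃ x₃₀ x₃₁ x₃₂ x₃₃ →
    x₂₀ * (x₁₁ * (x₂₂ * x₃₃ - x₂₃ * x₃₂) - x₁₂ * (x₂₁ * x₃₃ - x₂₃ * x₃₁) + x₁₃ * (x₂₁ * x₃₂ - x₂₂ * x₃₁))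
      + x₂₁ * - (x₁₀ * (x₂₂ * x₃₃ - x₂₃ * x₃₂) - x₁₂ * (x₂₀ * x₃₃ - x₂₃ * x₃₀) + x₁₃ * (x₂₀ * x₃₂ - x₂₂ * x₃₀))
      + x₂₂ * (x₁₀ * (x₂₁ * x₃₃ - x₂₃ * x₃₁) - x₁₁ * (x₂₀ * x₃₃ - x₂₃ * x₃₀) + x₁₃ * (x₂₀ * x₃₁ - x₂₁ * x₃₀))
      + x₂₃ * - (x₁₀ * (x₂₁ * x₃₂ - x₂₂ * x₃₁) - x₁₁ * (x₂₀ * x₃₂ - x₂₂ * x₃₀) + x₁₂ * (x₂₀ * x₃₁ - x₂₁ * x₃₀))
    ≡ + 0
  polynomial = solve-∀
·-cofactors₀ A (suc (suc (suc zero))) =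
  trans (polynomial (A f1 f0) (A f1 f1) (A f1 f2) (A f1 f3) (A f2 f0) (A f2 f1) (A f2 f2) (A f2 f3)
                    (A f3 f0) (A f3 f1) (A f3 f2) (A f3 f3))
        (sym (*-zeroʳ (det A)))
  where
  polynomial : ∀ x₁₀ x₁₁ x₁₂ x₁₃ x₂₀ x₂₁ x₂₂ x₂₃ x₃₀ x₃₁ x₃₂ x₃₃ →
    x₃₀ * (x₁₁ * (x₂₂ * x₃₃ - x₂₃ * x₃₂) - x₁₂ * (x₂₁ * x₃₃ - x₂₃ * x₃₁) + x₁₃ * (x₂₁ * x₃₂ - x₂₂ * x₃₁))
      + x₃₁ * - (x₁₀ * (x₂₂ * x₃₃ - x₂₃ * x₃₂) - x₁₂ * (x₂₀ * x₃₃ - x₂₃ * x₃₀) + x₁₃ * (x₂₀ * x₃₂ - x₂₂ * x₃₀))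
      + x₃₂ * (x₁₀ * (x₂₁ * x₃₃ - x₂₃ * x₃₁) - x₁₁ * (x₂₀ * x₃₃ - x₂₃ * x₃₀) + x₁₃ * (x₂₀ * x₃₁ - x₂₁ * x₃₀))
      + x₃₃ * - (x₁₀ * (x₂₁ * x₃₂ - x₂₂ * x₃₁) - x₁₁ * (x₂₀ * x₃₂ - x₂₂ * x₃₀) + x₁₂ * (x₂₀ * x₃₁ - x₂₁ * x₃₀))
    ≡ + 0
  polynomial = solve-∀

pf : Mat → ℤ
pf A = A f0 f1 * A f2 f3 - A f0 f2 * A f1 f3 + A f0 f3 * A f1 f2

pf-cong : ∀ {A B} → A ≈ B → pf A ≡ pf B
pf-cong p = cong₂ _+_ (cong₂ _-_ (cong₂ _*_ (p f0 f1) (p f2 f3)) (cong₂ _*_ (p f0 f2) (p f1 f3)))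
                      (cong₂ _*_ (p f0 f3) (p f1 f2))

-- pf (Aᵀ J A) = det A · pf J, and pf J = -1.
pf[AᵀJA]≡-det[A] : ∀ A → pf (transpose A · J · A) ≡ - det A
pf[AᵀJA]≡-det[A] A =
  trans (pf-cong (ω-entry (transpose A) (transpose A)))
        (polynomial (A f0 f0) (A f0 f1) (A f0 f2) (A f0 f3) (A f1 f0) (A f1 f1) (A f1 f2) (A f1 f3)
                    (A f2 f0) (A f2 f1) (A f2 f2) (A f2 f3) (A f3 f0) (A f3 f1) (A f3 f2) (A f3 f3))
  where
  polynomial : ∀ x₀₀ x₀₁ x₀₂ x₀₃ x₁₀ x₁₁ x₁₂ x₁₃ x₂₀ x₂₁ x₂₂ x₂₃ x₃₀ x₃₁ x₃₂ x₃₃ →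
    (x₀₀ * x₂₁ + x₁₀ * x₃₁ - x₂₀ * x₀₁ - x₃₀ * x₁₁) * (x₀₂ * x₂₃ + x₁₂ * x₃₃ - x₂₂ * x₀₃ - x₃₂ * x₁₃)
    - (x₀₀ * x₂₂ + x₁₀ * x₃₂ - x₂₀ * x₀₂ - x₃₀ * x₁₂) * (x₀₁ * x₂₃ + x₁₁ * x₃₃ - x₂₁ * x₀₃ - x₃₁ * x₁₃)
    + (x₀₀ * x₂₃ + x₁₀ * x₃₃ - x₂₀ * x₀₃ - x₃₀ * x₁₃) * (x₀₁ * x₂₂ + x₁₁ * x₃₂ - x₂₁ * x₀₂ - x₃₁ * x₁₂)
    ≡ - (x₀₀ * (x₁₁ * (x₂₂ * x₃₃ - x₂₃ * x₃₂) - x₁₂ * (x₂₁ * x₃₃ - x₂₃ * x₃₁) + x₁₃ * (x₂₁ * x₃₂ - x₂₂ * x₃₁))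
         + x₀₁ * - (x₁₀ * (x₂₂ * x₃₃ - x₂₃ * x₃₂) - x₁₂ * (x₂₀ * x₃₃ - x₂₃ * x₃₀) + x₁₃ * (x₂₀ * x₃₂ - x₂₂ * x₃₀))
         + x₀₂ * (x₁₀ * (x₂₁ * x₃₃ - x₂₃ * x₃₁) - x₁₁ * (x₂₀ * x₃₃ - x₂₃ * x₃₀) + x₁₃ * (x₂₀ * x₃₁ - x₂₁ * x₃₀))
         + x₀₃ * - (x₁₀ * (x₂₁ * x₃₂ - x₂₂ * x₃₁) - x₁₁ * (x₂₀ * x₃₂ - x₂₂ * x₃₀) + x₁₂ * (x₂₀ * x₃₁ - x₂₁ * x₃₀)))
  polynomial = solve-∀

det-symplectic : ∀ {A} → IsSp A → det A ≡ + 1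
det-symplectic {A} sp = neg-injective (trans (sym (pf[AᵀJA]≡-det[A] A)) (pf-cong sp))

·-scalar-column₀ : ∀ M c i → (M · λ k j → c * 1₄ k j) i f0 ≡ M i f0 * c
·-scalar-column₀ M c i = polynomial (M i f0) (M i f1) (M i f2) (M i f3) c
  where
  polynomial : ∀ m₀ m₁ m₂ m₃ c → m₀ * (c * + 1) + m₁ * (c * + 0) + m₂ * (c * + 0) + m₃ * (c * + 0) ≡ m₀ * c
  polynomial = solve-∀

-- M = N · spInverse N fixes N and has ω(N₃, N₂) as entry (3, 0); the first
-- column of M · N · cofactors₀ N then gives ω(N₃, N₂) · det N = 0.
isotropic-bottom-rows : ∀ {N} → IsSp N → ω (N f2) (N f3) ≡ + 0
isotropic-bottom-rows {N} sp = begin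
  ω (N f2) (N f3)                          ≡⟨ ω-antisym (N f2) (N f3) ⟩
  - ω (N f3) (N f2)                        ≡⟨ cong -_ (spInverse-lowerLeft N N (suc zero) zero) ⟨
  - M f3 f0                                ≡⟨ cong -_ (*-identityʳ (M f3 f0)) ⟨
  - (M f3 f0 * + 1)                        ≡⟨ cong (λ d → - (M f3 f0 * d)) (det-symplectic {N} sp) ⟨
  - (M f3 f0 * det N)                      ≡⟨ cong -_ (·-scalar-column₀ M (det N) f3) ⟨
  - (M · D) f3 f0
    ≡⟨ cong -_ (·-cong-entry {M} {M} {N · cofactors₀ N} {D} (λ _ → refl) (·-cofactors₀ N)) ⟨
  - (M · (N · cofactors₀ N)) f3 f0         ≡⟨ cong -_ (·-assoc M N (cofactors₀ N) f3 f0) ⟨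
  - (M · N · cofactors₀ N) f3 f0           ≡⟨ cong -_ (·-congˡ (cofactors₀ N) M·N≈N f3 f0) ⟩
  - (N · cofactors₀ N) f3 f0               ≡⟨ cong -_ (·-cofactors₀ N f3) ⟩
  - (det N * + 0)                          ≡⟨ cong -_ (*-zeroʳ (det N)) ⟩
  + 0                                      ∎
  where
  open Relation.Binary.PropositionalEquality.≡-Reasoning
  M : Mat
  M = N · spInverse N
  D : Mat
  D k j = det N * 1₄ k j
  M·N≈N : M · N ≈ N
  M·N≈N = ≈-trans (·-assoc N (spInverse N) N)
                  (≈-trans (·-congʳ N (spInverse-inverseˡ {N} sp)) (·-identityʳ N))

-- Congruences modulo m

infix 4 _≡_mod_
_≡_mod_ : ℤ → ℤ → ℤ → Set
x ≡ y mod m = m ∣ x - y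

≡⇒≡mod : ∀ {m x y} → x ≡ y → x ≡ y mod m
≡⇒≡mod {x = x} refl = divides (+ 0) (+-inverseʳ x)

≡mod-sym : ∀ {m x y} → x ≡ y mod m → y ≡ x mod m
≡mod-sym {m} {x} {y} p = subst (m ∣_) (polynomial x y) (∣m⇒∣-m p)
  where polynomial : ∀ x y → - (x - y) ≡ y - x
        polynomial = solve-∀

∣-resp-≡mod : ∀ {m x y} → x ≡ y mod m → m ∣ x → m ∣ y
∣-resp-≡mod {m} {x} {y} p m∣x = subst (m ∣_) (polynomial x y) (∣m∣n⇒∣m-n m∣x p)
  where polynomial : ∀ x y → x - (x - y) ≡ y
        polynomial = solve-∀

ω-∣ˡ : ∀ {m d} v → (∀ k → m ∣ d k) → m ∣ ω d v
ω-∣ˡ v p = ∣m∣n⇒∣m-n (∣m∣n⇒∣m-n (∣m∣n⇒∣m+n (∣m⇒∣m*n (v f2) (p f0)) (∣m⇒∣m*n (v f3) (p f1)))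
                                 (∣m⇒∣m*n (v f0) (p f2)))
                     (∣m⇒∣m*n (v f1) (p f3))

ω-∣ʳ : ∀ {m d} u → (∀ k → m ∣ d k) → m ∣ ω u d
ω-∣ʳ u p = ∣m∣n⇒∣m-n (∣m∣n⇒∣m-n (∣m∣n⇒∣m+n (∣n⇒∣m*n (u f0) (p f2)) (∣n⇒∣m*n (u f1) (p f3)))
                                 (∣n⇒∣m*n (u f2) (p f0)))
                     (∣n⇒∣m*n (u f3) (p f1))

ω-resp-≡mod : ∀ {m u u′ v v′} → (∀ k → u k ≡ u′ k mod m) → (∀ k → v k ≡ v′ k mod m) →
              ω u v ≡ ω u′ v′ mod m
ω-resp-≡mod {m} {u} {u′} {v} {v′} p q =
  subst (m ∣_) (sym (bilinear (u f0) (u f1) (u f2) (u f3) (u′ f0) (u′ f1) (u′ f2) (u′ f3)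
                              (v f0) (v f1) (v f2) (v f3) (v′ f0) (v′ f1) (v′ f2) (v′ f3)))
        (∣m∣n⇒∣m+n (ω-∣ˡ v p) (ω-∣ʳ u′ q))
  where
  bilinear : ∀ u₀ u₁ u₂ u₃ u′₀ u′₁ u′₂ u′₃ v₀ v₁ v₂ v₃ v′₀ v′₁ v′₂ v′₃ →
    u₀ * v₂ + u₁ * v₃ - u₂ * v₀ - u₃ * v₁ - (u′₀ * v′₂ + u′₁ * v′₃ - u′₂ * v′₀ - u′₃ * v′₁)
    ≡ (u₀ - u′₀) * v₂ + (u₁ - u′₁) * v₃ - (u₂ - u′₂) * v₀ - (u₃ - u′₃) * v₁
      + (u′₀ * (v₂ - v′₂) + u′₁ * (v₃ - v′₃) - u′₂ * (v₀ - v′₀) - u′₃ * (v₁ - v′₁))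
  bilinear = solve-∀

res : ℤ → ℤ
res x = + (x %ℕ 3)

≡res : ∀ x → x ≡ res x mod + 3
≡res x =
  divides (x /ℕ 3) (trans (cong (_- res x) (a≡a%ℕn+[a/ℕn]*n x 3)) (polynomial (res x) (x /ℕ 3)))
  where polynomial : ∀ r q → r + q * + 3 - r ≡ q * + 3
        polynomial = solve-∀

residues : List ℤ
residues = + 0 ∷ + 1 ∷ + 2 ∷ []

res∈residues : ∀ x → res x ∈ residues
res∈residues x with x %ℕ 3 | n%ℕd<d x 3
... | 0 | _ = here refl
... | 1 | _ = there (here refl)
... | 2 | _ = there (there (here refl))
... | ℕ.suc (ℕ.suc (ℕ.suc _)) | ℕ.s≤s (ℕ.s≤s (ℕ.s≤s ()))

infix 4 _∣?_
_∣?_ : Decidable _∣_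
m ∣? n = map′ ∣ᵤ⇒∣ ∣⇒∣ᵤ (ℤ.∣ m ∣ ℕ.∣? ℤ.∣ n ∣)

infix 4 _⊥₃_ _⊥₃?_
_⊥₃_ : (Fin 2 → Fin 4 → ℤ) → (Fin 2 → Fin 4 → ℤ) → Set
U ⊥₃ V = ∀ i j → + 3 ∣ ω (U i) (V j)

_⊥₃?_ : ∀ U V → Dec (U ⊥₃ V)
U ⊥₃? V = all? λ i → all? λ j → + 3 ∣? ω (U i) (V j)

⊥₃-resp : ∀ {U U′ V V′} → (∀ i k → U i k ≡ U′ i k mod + 3) → (∀ j k → V j k ≡ V′ j k mod + 3) →
          U ⊥₃ V → U′ ⊥₃ V′
⊥₃-resp {U} {U′} {V} {V′} p q U⊥V i j =
  ∣-resp-≡mod (ω-resp-≡mod {+ 3} {U i} {U′ i} {V j} {V′ j} (p i) (q j)) (U⊥V i j)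

candidate : Mat → Mat2 × Mat2 → Mat
candidate R (g , h) = R · ι g h

Valid : Mat → Mat2 × Mat2 → Set
Valid R (g , h) = IsSL2 g × IsSL2 h × IsSp (candidate R (g , h)) × IsSp (transpose (candidate R (g , h)))

inDoubleCoset : ∀ {R N} gh → IsSp N → Valid R gh → bottom N ⊥₃ bottom (candidate R gh) →
                InDoubleCoset R N
inDoubleCoset {R} {N} (g , h) spN (slg , slh , spQ , spQᵀ) N⊥Q =
  N · spInverse Q , ι g h ,
  (IsSp-· {N} {spInverse Q} spN (IsSp-spInverse {Q} spQᵀ) , lowerLeft) ,
  (g , h , slg , slh , ≈-refl) ,
  ≈-sym N≈
  where
  open SetoidReasoning ≈-setoid
  Q : Mat
  Q = R · ι g h
  lowerLeft : ∀ (i j : Fin 2) → + 3 Unsigned.∣ (N · spInverse Q) (suc (suc i)) (j ↑ˡ 2)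
  lowerLeft i j = ∣⇒∣ᵤ (subst (+ 3 ∣_) (sym (spInverse-lowerLeft N Q i j)) (N⊥Q i j))
  N≈ : N · spInverse Q · R · ι g h ≈ N
  N≈ = begin
    N · spInverse Q · R · ι g h  ≈⟨ ·-assoc (N · spInverse Q) R (ι g h) ⟩
    N · spInverse Q · Q          ≈⟨ ·-assoc N (spInverse Q) Q ⟩
    N · (spInverse Q · Q)        ≈⟨ ·-congʳ N (spInverse-inverseˡ {Q} spQ) ⟩
    N · 1₄                       ≈⟨ ·-identityʳ N ⟩
    N                            ∎

-- Covering isotropic pairs of residue rows

allVectors : ∀ {A : Set} → List A → ∀ n → List (Vec A n)
allVectors xs ℕ.zero = [] ∷ []
allVectors xs (ℕ.suc n) = cartesianProductWith _∷_ xs (allVectors xs n)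

tabulate∈allVectors : ∀ {A : Set} {xs : List A} {n} (v : Fin n → A) →
                      (∀ i → v i ∈ xs) → tabulate v ∈ allVectors xs n
tabulate∈allVectors {n = ℕ.zero} v p = here refl
tabulate∈allVectors {n = ℕ.suc n} v p =
  ∈-cartesianProductWith⁺ _∷_ (p zero) (tabulate∈allVectors (v ∘ suc) (p ∘ suc))

matrix : ∀ {m n} → Vec (Vec ℤ n) m → Fin m → Fin n → ℤ
matrix M i j = lookup (lookup M i) j

rows : ∀ {m n} → (Fin m → Fin n → ℤ) → Vec (Vec ℤ n) m
rows A = tabulate λ i → tabulate (A i)

matrix-rows : ∀ {m n} (A : Fin m → Fin n → ℤ) i j → matrix (rows A) i j ≡ A i j
matrix-rows A i j =
  trans (cong (λ r → lookup r j) (lookup∘tabulate (λ i → tabulate (A i)) i)) (lookup∘tabulate (A i) j)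

residueRows : Mat → Vec (Vec ℤ 4) 2
residueRows N = rows λ i k → res (bottom N i k)

Covered : List (Vec (Vec ℤ 4) 2) → Vec (Vec ℤ 4) 2 → Set
Covered Vs U = Any (λ V → matrix U ⊥₃ matrix V) Vs

covered? : ∀ Vs U → Dec (Covered Vs U)
covered? Vs U = any? (λ V → matrix U ⊥₃? matrix V) Vs

Coverage : (Ss Ms Ks : List (Vec (Vec ℤ 4) 2)) → Set
Coverage Ss Ms Ks =
  All (λ U → + 3 ∣ ω (matrix U zero) (matrix U (suc zero)) → Covered Ss U ⊎ Covered Ms U × Covered Ks U)
      (allVectors (allVectors residues 4) 2)

coverage? : ∀ Ss Ms Ks → Dec (Coverage Ss Ms Ks)
coverage? Ss Ms Ks =
  All.all? (λ U → (+ 3 ∣? ω (matrix U zero) (matrix U (suc zero))) →-dec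
                  (covered? Ss U ⊎-dec (covered? Ms U ×-dec covered? Ks U)))
           (allVectors (allVectors residues 4) 2)

mat₂ : ℤ → ℤ → ℤ → ℤ → Mat2
mat₂ a b c d zero zero = a
mat₂ a b c d zero (suc zero) = b
mat₂ a b c d (suc zero) zero = c
mat₂ a b c d (suc zero) (suc zero) = d

1₂ : Mat2
1₂ = mat₂ (+ 1) (+ 0) (+ 0) (+ 1)

_·₂_ : Mat2 → Mat2 → Mat2
(g ·₂ h) i j = g i zero * h zero j + g i (suc zero) * h (suc zero) j

-- Their bottom rows run through the four points of the projective line over 𝔽₃.
cosetReps : List Mat2
cosetReps =
  1₂ ∷ mat₂ (+ 0) (- + 1) (+ 1) (+ 0) ∷ mat₂ (+ 1) (+ 0) (+ 1) (+ 1) ∷ mat₂ (+ 0) (- + 1) (+ 1) (+ 2) ∷ []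

-- Lifts of the upper triangular matrices in SL₂(𝔽₃).
borelReps : List Mat2
borelReps = cartesianProductWith (λ a b → mat₂ a b (+ 0) a) (+ 1 ∷ - + 1 ∷ []) residues

-- The bottom rows of ι(g, h) with g, h ∈ cosetReps span modulo 3 the 16 Lagrangian
-- planes of 𝔽₃⁴ that are sums of a line in span(e₀, e₂) and one in span(e₁, e₃);
-- those of R · ι(1, h), with h running over the 24 lifts of SL₂(𝔽₃), span the
-- 24 others when R is M₁ or K.
splitPairs nonsplitPairs : List (Mat2 × Mat2)
splitPairs = cartesianProduct cosetReps cosetReps
nonsplitPairs = List.map (1₂ ,_) (cartesianProductWith _·₂_ borelReps cosetReps)

bottomRows : Mat → List (Mat2 × Mat2) → List (Vec (Vec ℤ 4) 2)
bottomRows R = List.map (rows ∘ bottom ∘ candidate R)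

valid? : ∀ R gh → Dec (Valid R gh)
valid? R (g , h) = (det₂ g ℤ.≟ + 1) ×-dec (det₂ h ℤ.≟ + 1) ×-dec (sp? Q) ×-dec sp? (transpose Q)
  where
  Q : Mat
  Q = candidate R (g , h)
  det₂ : Mat2 → ℤ
  det₂ g = g zero zero * g (suc zero) (suc zero) - g zero (suc zero) * g (suc zero) zero
  sp? : ∀ A → Dec (IsSp A)
  sp? A = transpose A · J · A ≈? J

valid-split : All (Valid 1₄) splitPairs
valid-split = from-yes (All.all? (valid? 1₄) splitPairs)

valid-M₁ : All (Valid M₁) nonsplitPairs
valid-M₁ = from-yes (All.all? (valid? M₁) nonsplitPairs)

valid-K : All (Valid K) nonsplitPairs
valid-K = from-yes (All.all? (valid? K) nonsplitPairs)

-- The lists are arguments of coverage? so that each of them is computed only once.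
coverage : Coverage (bottomRows 1₄ splitPairs) (bottomRows M₁ nonsplitPairs) (bottomRows K nonsplitPairs)
coverage = from-yes (coverage? (bottomRows 1₄ splitPairs) (bottomRows M₁ nonsplitPairs) (bottomRows K nonsplitPairs))

covered⇒InDoubleCoset : ∀ {R N} pairs → All (Valid R) pairs → IsSp N →
                        Covered (bottomRows R pairs) (residueRows N) → InDoubleCoset R N
covered⇒InDoubleCoset {R} {N} pairs valid spN covered =
  inDoubleCoset {R} {N} gh spN (proj₁ found)
    (⊥₃-resp {matrix (residueRows N)} {bottom N} {matrix (rows (bottom Q))} {bottom Q}
             residue-≡ entry-≡ (proj₂ found))
  where
  gh : Mat2 × Mat2
  gh = Any.lookup (map⁻ covered)
  Q : Mat
  Q = candidate R gh
  found : Valid R gh × matrix (residueRows N) ⊥₃ matrix (rows (bottom Q))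
  found = lookupAny valid (map⁻ covered)
  residue-≡ : ∀ i k → matrix (residueRows N) i k ≡ bottom N i k mod + 3
  residue-≡ i k = subst (_≡ bottom N i k mod + 3) (sym (matrix-rows (λ i k → res (bottom N i k)) i k))
                        (≡mod-sym {+ 3} {bottom N i k} (≡res (bottom N i k)))
  entry-≡ : ∀ j k → matrix (rows (bottom Q)) j k ≡ bottom Q j k mod + 3
  entry-≡ j k = ≡⇒≡mod {+ 3} (matrix-rows (bottom Q) j k)

double-cosets : ∀ N → IsSp N →
                (InDoubleCoset 1₄ N ⊎ InDoubleCoset M₁ N) × (InDoubleCoset 1₄ N ⊎ InDoubleCoset K N)
double-cosets N sp = by-coverage (All.lookup coverage N̄∈allVectors isotropic)
  where
  N̄ : Vec (Vec ℤ 4) 2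
  N̄ = residueRows N
  N̄∈allVectors : N̄ ∈ allVectors (allVectors residues 4) 2
  N̄∈allVectors = tabulate∈allVectors _ λ i → tabulate∈allVectors _ λ k → res∈residues (bottom N i k)
  isotropic : + 3 ∣ ω (res ∘ N f2) (res ∘ N f3)
  isotropic =
    ∣-resp-≡mod (ω-resp-≡mod {+ 3} {N f2} {res ∘ N f2} {N f3} {res ∘ N f3} (≡res ∘ N f2) (≡res ∘ N f3))
                (subst (+ 3 ∣_) (sym (isotropic-bottom-rows {N} sp)) (divides (+ 0) refl))
  by-coverage : Covered (bottomRows 1₄ splitPairs) N̄ ⊎
                Covered (bottomRows M₁ nonsplitPairs) N̄ × Covered (bottomRows K nonsplitPairs) N̄ →
                (InDoubleCoset 1₄ N ⊎ InDoubleCoset M₁ N) × (InDoubleCoset 1₄ N ⊎ InDoubleCoset K N)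
  by-coverage (inj₁ split) = inj₁ S , inj₁ S
    where S : InDoubleCoset 1₄ N
          S = covered⇒InDoubleCoset {1₄} {N} splitPairs valid-split sp split
  by-coverage (inj₂ (m , k)) = inj₂ (covered⇒InDoubleCoset {M₁} {N} nonsplitPairs valid-M₁ sp m) ,
                               inj₂ (covered⇒InDoubleCoset {K} {N} nonsplitPairs valid-K sp k)

-- M₁ and K are not in Γ₀(3) Γ_diag

bottomMinor : Mat → ℤ
bottomMinor A = A f2 f0 * A f3 f2 - A f2 f2 * A f3 f0

bottomMinor-cong : ∀ {A B} → A ≈ B → bottomMinor A ≡ bottomMinor B
bottomMinor-cong p = cong₂ _-_ (cong₂ _*_ (p f2 f0) (p f3 f2)) (cong₂ _*_ (p f2 f2) (p f3 f0))

bottomMinor-ι : ∀ γ g h →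
  bottomMinor (γ · ι g h)
    ≡ bottomMinor γ * (g zero zero * g (suc zero) (suc zero) - g zero (suc zero) * g (suc zero) zero)
bottomMinor-ι γ g h =
  polynomial (γ f2 f0) (γ f2 f1) (γ f2 f2) (γ f2 f3) (γ f3 f0) (γ f3 f1) (γ f3 f2) (γ f3 f3)
             (g zero zero) (g zero (suc zero)) (g (suc zero) zero) (g (suc zero) (suc zero))
  where
  polynomial : ∀ x₀ x₁ x₂ x₃ y₀ y₁ y₂ y₃ a b c d →
    (x₀ * a + x₁ * + 0 + x₂ * c + x₃ * + 0) * (y₀ * b + y₁ * + 0 + y₂ * d + y₃ * + 0)
      - (x₀ * b + x₁ * + 0 + x₂ * d + x₃ * + 0) * (y₀ * a + y₁ * + 0 + y₂ * c + y₃ * + 0)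
    ≡ (x₀ * y₂ - x₂ * y₀) * (a * d - b * c)
  polynomial = solve-∀

3∣bottomMinor : ∀ {A} → InDoubleCoset 1₄ A → + 3 ∣ bottomMinor A
3∣bottomMinor {A} (γ , δ , (_ , lowerLeft) , (g , h , slg , _ , δ≈ι) , A≈) =
  subst (+ 3 ∣_) (sym minor-A) (∣m⇒∣m*n (+ 1) 3∣minor-γ)
  where
  3∣minor-γ : + 3 ∣ bottomMinor γ
  3∣minor-γ = ∣m∣n⇒∣m-n (∣m⇒∣m*n (γ f3 f2) (∣ᵤ⇒∣ {+ 3} {γ f2 f0} (lowerLeft zero zero)))
                        (∣n⇒∣m*n (γ f2 f2) (∣ᵤ⇒∣ {+ 3} {γ f3 f0} (lowerLeft (suc zero) zero)))
  minor-A : bottomMinor A ≡ bottomMinor γ * + 1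
  minor-A = begin
    bottomMinor A             ≡⟨ bottomMinor-cong A≈ ⟩
    bottomMinor (γ · 1₄ · δ)  ≡⟨ bottomMinor-cong (·-cong (·-identityʳ γ) δ≈ι) ⟩
    bottomMinor (γ · ι g h)   ≡⟨ bottomMinor-ι γ g h ⟩
    bottomMinor γ * _         ≡⟨ cong (bottomMinor γ *_) slg ⟩
    bottomMinor γ * + 1       ∎
    where open Relation.Binary.PropositionalEquality.≡-Reasoning

M₁∉Γ₀3Γdiag : ¬ InDoubleCoset 1₄ M₁
M₁∉Γ₀3Γdiag = from-no (+ 3 ∣? bottomMinor M₁) ∘ 3∣bottomMinor

K∉Γ₀3Γdiag : ¬ InDoubleCoset 1₄ K
K∉Γ₀3Γdiag = from-no (+ 3 ∣? bottomMinor K) ∘ 3∣bottomMinor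

lemma4p1 : CompleteReps₂ 1₄ M₁ × CompleteReps₂ 1₄ K
lemma4p1 =
  (IsSp-1₄ , from-yes (transpose M₁ · J · M₁ ≈? J) , (λ N sp → proj₁ (double-cosets N sp)) , M₁∉Γ₀3Γdiag) ,
  (IsSp-1₄ , from-yes (transpose K · J · K ≈? J) , (λ N sp → proj₂ (double-cosets N sp)) , K∉Γ₀3Γdiag)
  where
  IsSp-1₄ : IsSp 1₄
  IsSp-1₄ = from-yes (transpose 1₄ · J · 1₄ ≈? J)
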